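{- Let $p$ be a prime, $r\ge1$, $G_r=\mathbb Z/p^r\mathbb Z$, and $a\in G_r\setminus\{0\}$ with $p^{r-1}\mid a$. Put $k=p^r-2$. If $\langle a_1,\dots,a_k\rangle$ is a multiset in $G_r\setminus\{0\}$ such that $\sum_{j\in S}a_j\ne a$ for every subset $S\subseteq\{1,\dots,k\}$, then $\langle a_1,\dots,a_k\rangle=\mathfrak M_{p,r,a}(b)$ for some $b\in G_r$ with $p\nmid b$.
   Context: For $b\in G_r$ with $p\nmid b$, let $n$ be the least nonnegative integer with $n\equiv ab^{ -1}-1\pmod{p^r}$; then $\mathfrak M_{p,r,a}(b)$ is the multiset $\langle a_1,\dots,a_k\rangle$ ($k=p^r-2$) with $a_j=b$ for $j\le n$ and $a_j=-b$ for $j\ge n+1$, i.e. $n$ copies of $b$ and $k-n$ copies of $-b$. -}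

module Defs where

open import Data.Nat using (ℕ; zero; suc; _+_; _*_; _∸_; _^_; _<_; _≤_; _<ᵇ_)
open import Data.Nat.DivMod using (_%_)
open import Data.Bool using (Bool; true; false; if_then_else_)
open import Data.Fin using (Fin; toℕ)
open import Data.Vec using (Vec; []; _∷_; tabulate)

-- Reduction modulo N (N = p^r ≥ 1 in all uses; the N = 0 clause is never used).
_mod_ : ℕ → ℕ → ℕ
m mod zero  = m
m mod suc n = m % suc n

-- Elements of G_r = ℤ/p^rℤ are represented by their canonical residues x < p^r.
-- Negation in ℤ/Nℤ on residues.
negMod : ℕ → ℕ → ℕ
negMod N x = (N ∸ x) mod N

subsetSum : ∀ {k} → Vec Bool k → Vec ℕ k → ℕ
subsetSum []            []       = 0
subsetSum (true  ∷ bs) (x ∷ xs) = x + subsetSum bs xs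
subsetSum (false ∷ bs) (x ∷ xs) = subsetSum bs xs

-- 𝔐_{p,r,a}(b): given N = p^r, the inverse binv of b modulo N, and a,
-- n = least nonnegative integer ≡ a·b⁻¹ − 1 (mod N), i.e. n = (a·binv + (N−1)) mod N,
-- and a_j = b for j ≤ n, a_j = −b for j ≥ n+1  (j = 1,…,k, k = N − 2).
mfrakN : (N a binv : ℕ) → ℕ
mfrakN N a binv = (a * binv + (N ∸ 1)) mod N

Mfrak : (N a b binv : ℕ) → Vec ℕ (N ∸ 2)
Mfrak N a b binv =
  tabulate λ (j : Fin (N ∸ 2)) →
    if toℕ j <ᵇ mfrakN N a binv then b else negMod N b

-- Write Σ(l) for the set of subset sums of a sequence l in ℤ/N, N = p^r. Because p^(r−1) ∣ a,
-- every nonzero x generates a subgroup containing a; so if 0 ∈ A and a ∉ A + {0, x}, then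
-- A + {0, x} is strictly larger than A, for otherwise A would be closed under adding x and
-- contain a. Hence N − 2 nonzero residues whose subset sums avoid a have |Σ| ≥ N − 1: Σ is
-- everything except a. Two terms x, y with y ∉ {x, −x} are then impossible, since
-- {0, x, y, x + y} already has four elements and the other N − 4 terms add N − 4 more.
-- So the sequence is n copies of x and m copies of −x. If p ∣ x, all subset sums are
-- multiples of p, yet 1 or −1 lies in Σ; so x is a unit. Writing a = c x, the sums t x with
-- −m ≤ t ≤ n miss a only if c = n + 1, as n + m = N − 2.
module Submission where

open import Defs
open import Data.Nat using (ℕ; _^_; _∸_; _<_; _*_; _≤_)
open import Data.Nat.Divisibility using (_∣_)
open import Data.Nat.Primality using (Prime)
open import Data.Bool using (Bool)
open import Data.Vec using (Vec; toList)
open import Data.Vec.Relation.Unary.All using (All)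
open import Data.List.Relation.Binary.Permutation.Propositional using (_↭_)
open import Data.Product using (Σ; _×_; ∃)
open import Relation.Nullary using (¬_)
open import Relation.Binary.PropositionalEquality using (_≡_; _≢_)

open import Data.Bool using (true; false; if_then_else_)
open import Data.Empty using (⊥; ⊥-elim)
open import Data.Fin using (Fin; toℕ; fromℕ<)
import Data.Fin as Fin
open import Data.Fin.Properties using (toℕ-fromℕ<; fromℕ<-cong; toℕ-injective; toℕ<n)
open import Data.Fin.Subset using (Subset; _∈_; _∉_; _⊆_; _⊂_; _∪_; ⁅_⁆; ∣_∣; ⊤)
open import Data.Fin.Subset.Properties
  using (_∈?_; ∈⊤; ⊆⊤; ∣⊤∣≡n; ∣p∣≤n; ∣p∣≡n⇒p≡⊤; p⊂q⇒∣p∣<∣q∣; x∈⁅x⁆; x∈⁅y⁆⇒x≡y; ∣⁅x⁆∣≡1;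
         p⊆p∪q; q⊆p∪q; x∈p∪q⁺; x∈p∪q⁻)
open import Data.List using (List; []; _∷_; foldr; length; replicate; _++_)
open import Data.List.Properties using (foldr-++; length-++; length-replicate)
open import Data.List.Membership.Propositional using () renaming (_∈_ to _∈ₗ_)
open import Data.List.Membership.Propositional.Properties using (∈-∃++)
import Data.List.Relation.Unary.All as List
open import Data.List.Relation.Unary.All using ([]; _∷_)
import Data.List.Relation.Binary.Permutation.Propositional as ↭
open import Data.List.Relation.Binary.Permutation.Propositional.Properties
  using (++-comm; shift; ↭-length; All-resp-↭)
open import Data.Nat
open import Data.Nat.Properties
open import Data.Nat.Coprimality using (Coprime; coprime-divisor; coprime⇒GCD≡1)
open import Data.Nat.Divisibility
open import Data.Nat.DivMod
  using (_%_; %-distribˡ-+; %-distribˡ-*; m%n%n≡m%n; m%n<n; [m+kn]%n≡m%n; [m+n]%n≡m%n; m<n⇒m%n≡m)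
open import Data.Nat.GCD using (GCD; gcd; gcd-GCD; gcd[m,n]∣m; gcd[m,n]∣n; module Bézout)
open import Data.Nat.Primality using (prime⇒irreducible; prime⇒nonZero; prime⇒nonTrivial)
open import Data.Nat.Solver using (module +-*-Solver)
open import Data.Product using (_,_; proj₁; ∃₂)
open import Data.Sum using (_⊎_; inj₁; inj₂; [_,_]′)
import Data.Sum as Sum
open import Data.Vec using ([]; _∷_; tabulate; lookup)
open import Data.Vec.Properties using (lookup∘tabulate; lookup⇒[]=; []=⇒lookup; length-toList)
open import Data.Vec.Relation.Unary.All using ([]; _∷_)
import Data.Vec.Relation.Unary.All as VecAll
open import Data.Vec.Relation.Unary.All.Properties using (toList⁺)
open import Function using (_∘_)
open import Relation.Binary.Definitions using (tri<; tri≈; tri>)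
open import Relation.Binary.PropositionalEquality
  using (refl; sym; trans; cong; cong₂; subst; subst₂; module ≡-Reasoning)
open import Relation.Nullary using (yes; no; contradiction)
open import Relation.Unary using (Pred; Decidable)

open +-*-Solver

mod≡% : ∀ m n .{{_ : NonZero n}} → m mod n ≡ m % n
mod≡% m (suc n) = refl

[m%n+o]%n≡[m+o]%n : ∀ m o n .{{_ : NonZero n}} → (m % n + o) % n ≡ (m + o) % n
[m%n+o]%n≡[m+o]%n m o n = begin
  (m % n + o) % n         ≡⟨ %-distribˡ-+ (m % n) o n ⟩
  (m % n % n + o % n) % n ≡⟨ cong (λ z → (z + o % n) % n) (m%n%n≡m%n m n) ⟩
  (m % n + o % n) % n     ≡⟨ %-distribˡ-+ m o n ⟨
  (m + o) % n             ∎
  where open ≡-Reasoning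

[m%n*o]%n≡[m*o]%n : ∀ m o n .{{_ : NonZero n}} → (m % n * o) % n ≡ (m * o) % n
[m%n*o]%n≡[m*o]%n m o n = begin
  (m % n * o) % n         ≡⟨ %-distribˡ-* (m % n) o n ⟩
  (m % n % n * (o % n)) % n ≡⟨ cong (λ z → (z * (o % n)) % n) (m%n%n≡m%n m n) ⟩
  (m % n * (o % n)) % n   ≡⟨ %-distribˡ-* m o n ⟨
  (m * o) % n             ∎
  where open ≡-Reasoning

[m*[o%n]]%n≡[m*o]%n : ∀ m o n .{{_ : NonZero n}} → (m * (o % n)) % n ≡ (m * o) % n
[m*[o%n]]%n≡[m*o]%n m o n = begin
  (m * (o % n)) % n ≡⟨ cong (_% n) (*-comm m (o % n)) ⟩
  (o % n * m) % n   ≡⟨ [m%n*o]%n≡[m*o]%n o m n ⟩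
  (o * m) % n       ≡⟨ cong (_% n) (*-comm o m) ⟩
  (m * o) % n       ∎
  where open ≡-Reasoning

[n∸m]*[n∸o]%n≡m*o%n : ∀ m o n .{{_ : NonZero n}} → m ≤ n → o ≤ n →
                      ((n ∸ m) * (n ∸ o)) % n ≡ (m * o) % n
[n∸m]*[n∸o]%n≡m*o%n m o n m≤n o≤n = begin
  (u * w) % n                 ≡⟨ [m+kn]%n≡m%n (u * w) (o + m) n ⟨
  (u * w + (o + m) * n) % n   ≡⟨ cong (_% n) key ⟩
  (m * o + n * n) % n         ≡⟨ [m+kn]%n≡m%n (m * o) n n ⟩
  (m * o) % n                 ∎
  where
  open ≡-Reasoning
  u w : ℕ
  u = n ∸ m
  w = n ∸ o
  n≡u+m : n ≡ u + m
  n≡u+m = sym (m∸n+n≡m m≤n)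
  n≡w+o : n ≡ w + o
  n≡w+o = sym (m∸n+n≡m o≤n)
  -- substitute u + m for n in some places and w + o in others, leaving a semiring identity
  key : u * w + (o + m) * n ≡ m * o + n * n
  key = begin
    u * w + (o + m) * n                 ≡⟨ cong (u * w +_) (*-distribʳ-+ n o m) ⟩
    u * w + (o * n + m * n)             ≡⟨ cong₂ (λ s t → u * w + (o * s + m * t)) n≡u+m n≡w+o ⟩
    u * w + (o * (u + m) + m * (w + o)) ≡⟨ solve 4 (λ u w m o → u :* w :+ (o :* (u :+ m) :+ m :* (w :+ o))
                                                  := m :* o :+ (u :+ m) :* (w :+ o)) refl u w m o ⟩
    m * o + (u + m) * (w + o)           ≡⟨ cong₂ (λ s t → m * o + s * t) n≡u+m n≡w+o ⟨
    m * o + n * n                       ∎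

∣m∣n⇒∣m∸n : ∀ {d m n} → d ∣ m → d ∣ n → d ∣ m ∸ n
∣m∣n⇒∣m∸n {d} {m} {n} d∣m d∣n with ≤-total n m
... | inj₁ n≤m = ∣m+n∣m⇒∣n (subst (d ∣_) (sym (m+[n∸m]≡n n≤m)) d∣m) d∣n
... | inj₂ m≤n = subst (d ∣_) (sym (m≤n⇒m∸n≡0 m≤n)) (d ∣0)

¬∣⇒coprime : ∀ {p m} → Prime p → ¬ p ∣ m → Coprime m p
¬∣⇒coprime pr p∤m (d∣m , d∣p) with prime⇒irreducible pr d∣p
... | inj₁ d≡1 = d≡1
... | inj₂ refl = contradiction d∣m p∤m

¬∣⇒coprime-^ : ∀ {p m} → Prime p → ¬ p ∣ m → ∀ k → Coprime m (p ^ k)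
¬∣⇒coprime-^ pr p∤m zero    (_ , d∣1) = ∣1⇒≡1 d∣1
¬∣⇒coprime-^ {p} pr p∤m (suc k) {d} (d∣m , d∣p^[1+k]) =
  ¬∣⇒coprime-^ pr p∤m k (d∣m , coprime-divisor d⊥p d∣p^[1+k])
  where
  d⊥p : Coprime d p
  d⊥p = ¬∣⇒coprime pr (p∤m ∘ λ p∣d → ∣-trans p∣d d∣m)

∣p^[1+k]∧<⇒∣p^k : ∀ {p d} k → Prime p → d ∣ p ^ suc k → d < p ^ suc k → d ∣ p ^ k
∣p^[1+k]∧<⇒∣p^k {p} {d} k pr (divides e p^[1+k]≡e*d) d<p^[1+k] with p ∣? e
... | yes (divides f refl) = divides f (*-cancelˡ-≡ (p ^ k) (f * d) p (begin
      p * p ^ k   ≡⟨ p^[1+k]≡e*d ⟩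
      f * p * d   ≡⟨ solve 3 (λ f p d → f :* p :* d := p :* (f :* d)) refl f p d ⟩
      p * (f * d) ∎))
  where
  open ≡-Reasoning
  instance
    p≢0 : NonZero p
    p≢0 = prime⇒nonZero pr
... | no p∤e = contradiction (sym p^[1+k]≡d) (<⇒≢ d<p^[1+k])
  where
  e≡1 : e ≡ 1
  e≡1 = ¬∣⇒coprime-^ pr p∤e (suc k) (∣-refl , divides d (trans p^[1+k]≡e*d (*-comm e d)))
  p^[1+k]≡d : p ^ suc k ≡ d
  p^[1+k]≡d = trans p^[1+k]≡e*d (trans (cong (_* d) e≡1) (*-identityˡ d))

Bézout-% : ∀ {m n d} .{{_ : NonZero n}} → GCD m n d → ∃ λ t → (t * m) % n ≡ d % n
Bézout-% {m} {n} {d} g with Bézout.identity g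
... | Bézout.+- x y d+y*n≡x*m = x , (begin
  (x * m) % n     ≡⟨ cong (_% n) d+y*n≡x*m ⟨
  (d + y * n) % n ≡⟨ [m+kn]%n≡m%n d y n ⟩
  d % n           ∎)
  where open ≡-Reasoning
Bézout-% {m} {n@(suc n-1)} {d} g | Bézout.-+ x y d+x*m≡y*n = x * n-1 , (begin
  (x * n-1 * m) % n                     ≡⟨ [m+kn]%n≡m%n (x * n-1 * m) y n ⟨
  (x * n-1 * m + y * n) % n             ≡⟨ cong (λ z → (x * n-1 * m + z) % n) d+x*m≡y*n ⟨
  (x * n-1 * m + (d + x * m)) % n       ≡⟨ cong (_% n) (solve 4 (λ x n-1 m d →
                                             x :* n-1 :* m :+ (d :+ x :* m) := d :+ x :* m :* (con 1 :+ n-1))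
                                             refl x n-1 m d) ⟩
  (d + x * m * n) % n                   ≡⟨ [m+kn]%n≡m%n d (x * m) n ⟩
  d % n                                 ∎)
  where open ≡-Reasoning

¬∣⇒∃inverse : ∀ {p b} k .{{_ : NonZero (p ^ k)}} → Prime p → ¬ p ∣ b →
              ∃ λ b⁻¹ → b⁻¹ < p ^ k × (b * b⁻¹) % p ^ k ≡ 1 % p ^ k
¬∣⇒∃inverse {p} {b} k pr p∤b with t , t*b≡1 ← Bézout-% (coprime⇒GCD≡1 (¬∣⇒coprime-^ pr p∤b k)) =
  t % N , m%n<n t N , (begin
    (b * (t % N)) % N ≡⟨ [m*[o%n]]%n≡[m*o]%n b t N ⟩
    (b * t) % N       ≡⟨ cong (_% N) (*-comm b t) ⟩
    (t * b) % N       ≡⟨ t*b≡1 ⟩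
    1 % N             ∎)
  where
  open ≡-Reasoning
  N : ℕ
  N = p ^ k

p^k∣a⇒a∈⟨x⟩ : ∀ {p a x} k .{{_ : NonZero (p ^ suc k)}} → Prime p → p ^ k ∣ a → 0 < x → x < p ^ suc k →
              ∃ λ t → (t * x) % p ^ suc k ≡ a % p ^ suc k
p^k∣a⇒a∈⟨x⟩ {p} {a} {x@(suc _)} k pr p^k∣a _ x<N with Bézout-% (gcd-GCD x (p ^ suc k))
... | t , t*x≡d = q * t , (begin
  (q * t * x) % N         ≡⟨ cong (_% N) (*-assoc q t x) ⟩
  (q * (t * x)) % N       ≡⟨ [m*[o%n]]%n≡[m*o]%n q (t * x) N ⟨
  (q * ((t * x) % N)) % N ≡⟨ cong (λ z → (q * z) % N) t*x≡d ⟩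
  (q * (d % N)) % N       ≡⟨ [m*[o%n]]%n≡[m*o]%n q d N ⟩
  (q * d) % N             ≡⟨ cong (_% N) a≡q*d ⟨
  a % N                   ∎)
  where
  open ≡-Reasoning
  N d : ℕ
  N = p ^ suc k
  d = gcd x N
  d∣a : d ∣ a
  d∣a = ∣-trans (∣p^[1+k]∧<⇒∣p^k k pr (gcd[m,n]∣n x N) (≤-<-trans (∣⇒≤ (gcd[m,n]∣m x N)) x<N)) p^k∣a
  q : ℕ
  q = quotient d∣a
  a≡q*d : a ≡ q * d
  a≡q*d = m∣n⇒n≡quotient*m d∣a

∉⇒∣p∣<n : ∀ {n} {p : Subset n} {x} → x ∉ p → ∣ p ∣ < n
∉⇒∣p∣<n {n} {p} {x} x∉p = ≤∧≢⇒< (∣p∣≤n p) (λ ∣p∣≡n → x∉p (subst (x ∈_) (sym (∣p∣≡n⇒p≡⊤ ∣p∣≡n)) ∈⊤))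

x,y∈q─p⇒2+∣p∣≤∣q∣ : ∀ {n} {p q : Subset n} {x y} → p ⊆ q → x ∈ q → y ∈ q → x ∉ p → y ∉ p → x ≢ y →
                    2 + ∣ p ∣ ≤ ∣ q ∣
x,y∈q─p⇒2+∣p∣≤∣q∣ {p = p} {q} {x} {y} p⊆q x∈q y∈q x∉p y∉p x≢y = begin
  2 + ∣ p ∣          ≤⟨ s≤s (p⊂q⇒∣p∣<∣q∣ p⊂p∪⁅x⁆) ⟩
  suc ∣ p ∪ ⁅ x ⁆ ∣  ≤⟨ p⊂q⇒∣p∣<∣q∣ p∪⁅x⁆⊂q ⟩
  ∣ q ∣              ∎
  where
  open ≤-Reasoning
  p⊂p∪⁅x⁆ : p ⊂ p ∪ ⁅ x ⁆
  p⊂p∪⁅x⁆ = p⊆p∪q _ , x , x∈p∪q⁺ (inj₂ (x∈⁅x⁆ x)) , x∉p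
  p∪⁅x⁆⊂q : p ∪ ⁅ x ⁆ ⊂ q
  p∪⁅x⁆⊂q = [ p⊆q , (λ z∈⁅x⁆ → subst (_∈ q) (sym (x∈⁅y⁆⇒x≡y x z∈⁅x⁆)) x∈q) ]′ ∘ x∈p∪q⁻ p ⁅ x ⁆
          , y , y∈q , [ y∉p , x≢y ∘ sym ∘ x∈⁅y⁆⇒x≡y x ]′ ∘ x∈p∪q⁻ p ⁅ x ⁆

boundary : ∀ {ℓ} {P : Pred ℕ ℓ} → Decidable P → P 0 → ∀ n → ¬ P n → ∃ λ t → P t × ¬ P (suc t)
boundary P? P0 zero    ¬P0      = contradiction P0 ¬P0
boundary P? P0 (suc n) ¬P[1+n] with P? n
... | yes Pn  = n , Pn , ¬P[1+n]
... | no  ¬Pn = boundary P? P0 n ¬Pn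

All-≡∨≡⇒↭replicate : ∀ {a} {A : Set a} {b c : A} l → List.All (λ y → y ≡ b ⊎ y ≡ c) l →
                     ∃₂ λ n m → l ↭ replicate n b ++ replicate m c
All-≡∨≡⇒↭replicate []      []                = 0 , 0 , ↭.refl
All-≡∨≡⇒↭replicate (y ∷ l) (inj₁ refl ∷ l-ok) with n , m , π ← All-≡∨≡⇒↭replicate l l-ok = suc n , m , ↭.prep y π
All-≡∨≡⇒↭replicate {b = b} {c} (y ∷ l) (inj₂ refl ∷ l-ok) with n , m , π ← All-≡∨≡⇒↭replicate l l-ok =
  n , suc m , ↭.trans (↭.prep y π) (↭.↭-sym (shift y (replicate n b) (replicate m c)))

length-replicate-++ : ∀ {a} {A : Set a} n m {b c : A} → length (replicate n b ++ replicate m c) ≡ n + m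
length-replicate-++ n m = trans (length-++ (replicate n _)) (cong₂ _+_ (length-replicate n) (length-replicate m))

toList-tabulate-<ᵇ : ∀ {a} {A : Set a} (b c : A) {k n} → n ≤ k →
                     toList (tabulate {n = k} (λ j → if toℕ j <ᵇ n then b else c))
                       ≡ replicate n b ++ replicate (k ∸ n) c
toList-tabulate-<ᵇ b c {zero}  {zero}  _         = refl
toList-tabulate-<ᵇ b c {suc k} {zero}  _         = cong (c ∷_) (toList-tabulate-<ᵇ b c z≤n)
toList-tabulate-<ᵇ b c {suc k} {suc n} (s≤s n≤k) = cong (b ∷_) (toList-tabulate-<ᵇ b c n≤k)

module Residues (N : ℕ) .{{_ : NonZero N}} where

  [_] : ℕ → Fin N
  [ u ] = fromℕ< (m%n<n u N)

  toℕ-[] : ∀ u → toℕ [ u ] ≡ u % N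
  toℕ-[] u = toℕ-fromℕ< (m%n<n u N)

  []-cong : ∀ {u w} → u % N ≡ w % N → [ u ] ≡ [ w ]
  []-cong u≡w = fromℕ<-cong _ _ u≡w _ _

  toℕ-[]-< : ∀ {u} → u < N → toℕ [ u ] ≡ u
  toℕ-[]-< {u} u<N = trans (toℕ-[] u) (m<n⇒m%n≡m u<N)

  []-toℕ : ∀ v → [ toℕ v ] ≡ v
  []-toℕ v = toℕ-injective (toℕ-[]-< (toℕ<n v))

  [toℕ[u]+w] : ∀ u w → [ toℕ [ u ] + w ] ≡ [ u + w ]
  [toℕ[u]+w] u w = []-cong (trans (cong (λ z → (z + w) % N) (toℕ-[] u)) ([m%n+o]%n≡[m+o]%n u w N))

  [u+toℕ[w]] : ∀ u w → [ u + toℕ [ w ] ] ≡ [ u + w ]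
  [u+toℕ[w]] u w = trans (cong [_] (+-comm u _)) (trans ([toℕ[u]+w] w u) (cong [_] (+-comm w u)))

  [u+N] : ∀ u → [ u + N ] ≡ [ u ]
  [u+N] u = []-cong ([m+n]%n≡m%n u N)

  x+u+[N∸x]≡u+N : ∀ {x} u → x ≤ N → x + u + (N ∸ x) ≡ u + N
  x+u+[N∸x]≡u+N {x} u x≤N = begin
    x + u + (N ∸ x)   ≡⟨ cong (_+ (N ∸ x)) (+-comm x u) ⟩
    u + x + (N ∸ x)   ≡⟨ +-assoc u x (N ∸ x) ⟩
    u + (x + (N ∸ x)) ≡⟨ cong (u +_) (m+[n∸m]≡n x≤N) ⟩
    u + N             ∎
    where open ≡-Reasoning

  _⊖_ : Fin N → ℕ → Fin N
  v ⊖ x = [ toℕ v + (N ∸ x) ]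

  [x+u]⊖x≡[u] : ∀ {x} u → x ≤ N → [ x + u ] ⊖ x ≡ [ u ]
  [x+u]⊖x≡[u] {x} u x≤N = begin
    [ toℕ [ x + u ] + (N ∸ x) ] ≡⟨ [toℕ[u]+w] (x + u) (N ∸ x) ⟩
    [ x + u + (N ∸ x) ]         ≡⟨ cong [_] (x+u+[N∸x]≡u+N u x≤N) ⟩
    [ u + N ]                   ≡⟨ [u+N] u ⟩
    [ u ]                       ∎
    where open ≡-Reasoning

  [x+v⊖x]≡v : ∀ {x} v → x ≤ N → [ x + toℕ (v ⊖ x) ] ≡ v
  [x+v⊖x]≡v {x} v x≤N = begin
    [ x + toℕ [ toℕ v + (N ∸ x) ] ] ≡⟨ [u+toℕ[w]] x (toℕ v + (N ∸ x)) ⟩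
    [ x + (toℕ v + (N ∸ x)) ]       ≡⟨ cong [_] (+-assoc x (toℕ v) (N ∸ x)) ⟨
    [ x + toℕ v + (N ∸ x) ]         ≡⟨ cong [_] (x+u+[N∸x]≡u+N (toℕ v) x≤N) ⟩
    [ toℕ v + N ]                   ≡⟨ [u+N] (toℕ v) ⟩
    [ toℕ v ]                       ≡⟨ []-toℕ v ⟩
    v                               ∎
    where open ≡-Reasoning

  ⊖-comm : ∀ v x y → (v ⊖ x) ⊖ y ≡ (v ⊖ y) ⊖ x
  ⊖-comm v x y = begin
    [ toℕ [ toℕ v + (N ∸ x) ] + (N ∸ y) ] ≡⟨ [toℕ[u]+w] (toℕ v + (N ∸ x)) (N ∸ y) ⟩
    [ toℕ v + (N ∸ x) + (N ∸ y) ]         ≡⟨ cong [_] (solve 3 (λ v s t → v :+ s :+ t := v :+ t :+ s)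
                                                              refl (toℕ v) (N ∸ x) (N ∸ y)) ⟩
    [ toℕ v + (N ∸ y) + (N ∸ x) ]         ≡⟨ [toℕ[u]+w] (toℕ v + (N ∸ y)) (N ∸ x) ⟨
    [ toℕ [ toℕ v + (N ∸ y) ] + (N ∸ x) ] ∎
    where open ≡-Reasoning

  translate : ℕ → Subset N → Subset N
  translate x B = tabulate (λ v → lookup B (v ⊖ x))

  extend : ℕ → Subset N → Subset N
  extend x B = B ∪ translate x B

  ∈-extend⁺ˡ : ∀ x {B v} → v ∈ B → v ∈ extend x B
  ∈-extend⁺ˡ x = p⊆p∪q _

  ∈-extend⁺ʳ : ∀ x {B v} → v ⊖ x ∈ B → v ∈ extend x B
  ∈-extend⁺ʳ x {B} {v} v⊖x∈B =
    q⊆p∪q B _ (lookup⇒[]= v _ (trans (lookup∘tabulate _ v) ([]=⇒lookup v⊖x∈B)))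

  ∈-extend⁻ : ∀ x {B v} → v ∈ extend x B → v ∈ B ⊎ v ⊖ x ∈ B
  ∈-extend⁻ x {B} {v} v∈ = Sum.map₂ (λ v∈translate → lookup⇒[]= (v ⊖ x) B
    (trans (sym (lookup∘tabulate _ v)) ([]=⇒lookup v∈translate))) (x∈p∪q⁻ B _ v∈)

  [x+u]∈extend : ∀ {x B} u → x ≤ N → [ u ] ∈ B → [ x + u ] ∈ extend x B
  [x+u]∈extend {x} u x≤N u∈B = ∈-extend⁺ʳ x (subst (_∈ _) (sym ([x+u]⊖x≡[u] u x≤N)) u∈B)

  extend-mono : ∀ x {B C} → B ⊆ C → extend x B ⊆ extend x C
  extend-mono x B⊆C v∈ with ∈-extend⁻ x v∈
  ... | inj₁ v∈B    = ∈-extend⁺ˡ x (B⊆C v∈B)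
  ... | inj₂ v⊖x∈B = ∈-extend⁺ʳ x (B⊆C v⊖x∈B)

  extend-comm : ∀ x y {B} → extend x (extend y B) ⊆ extend y (extend x B)
  extend-comm x y {B} {v} v∈ with ∈-extend⁻ x v∈
  ... | inj₁ v∈yB with ∈-extend⁻ y v∈yB
  ...   | inj₁ v∈B    = ∈-extend⁺ˡ y (∈-extend⁺ˡ x v∈B)
  ...   | inj₂ v⊖y∈B = ∈-extend⁺ʳ y (∈-extend⁺ˡ x v⊖y∈B)
  extend-comm x y {B} {v} v∈ | inj₂ v⊖x∈yB with ∈-extend⁻ y v⊖x∈yB
  ...   | inj₁ v⊖x∈B    = ∈-extend⁺ˡ y (∈-extend⁺ʳ x v⊖x∈B)
  ...   | inj₂ v⊖x⊖y∈B = ∈-extend⁺ʳ y (∈-extend⁺ʳ x (subst (_∈ _) (⊖-comm v x y) v⊖x⊖y∈B))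

  -- foldr extend A l is A + Σ(l), Σ(l) being the set of subset sums of l
  sums : List ℕ → Subset N
  sums = foldr extend ⁅ [ 0 ] ⁆

  ⊆-foldr-extend : ∀ {A} l → A ⊆ foldr extend A l
  ⊆-foldr-extend []      v∈A = v∈A
  ⊆-foldr-extend (x ∷ l) v∈A = ∈-extend⁺ˡ x (⊆-foldr-extend l v∈A)

  [0]∈sums : ∀ l → [ 0 ] ∈ sums l
  [0]∈sums l = ⊆-foldr-extend l (x∈⁅x⁆ [ 0 ])

  sums-↭ : ∀ {l l'} → l ↭ l' → sums l ⊆ sums l'
  sums-↭ ↭.refl            = λ v∈ → v∈
  sums-↭ (↭.prep x l↭l')   = extend-mono x (sums-↭ l↭l')
  sums-↭ (↭.swap x y l↭l') = extend-comm x y ∘ extend-mono x (extend-mono y (sums-↭ l↭l'))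
  sums-↭ (↭.trans l↭m m↭l') = sums-↭ m↭l' ∘ sums-↭ l↭m

  ∈sums⇒subsetSum : ∀ {k} (as : Vec ℕ k) → All (_≤ N) as →
                    ∀ {v} → v ∈ sums (toList as) → ∃ λ S → [ subsetSum S as ] ≡ v
  ∈sums⇒subsetSum []       [] v∈ = [] , sym (x∈⁅y⁆⇒x≡y _ v∈)
  ∈sums⇒subsetSum (x ∷ as) (x≤N ∷ as≤N) {v} v∈ with ∈-extend⁻ x v∈
  ... | inj₁ v∈sums with S , [S]≡v ← ∈sums⇒subsetSum as as≤N v∈sums = false ∷ S , [S]≡v
  ... | inj₂ v⊖x∈sums with S , [S]≡v⊖x ← ∈sums⇒subsetSum as as≤N v⊖x∈sums =
    true ∷ S , (begin
      [ x + subsetSum S as ]        ≡⟨ [u+toℕ[w]] x (subsetSum S as) ⟨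
      [ x + toℕ [ subsetSum S as ] ] ≡⟨ cong (λ w → [ x + toℕ w ]) [S]≡v⊖x ⟩
      [ x + toℕ (v ⊖ x) ]           ≡⟨ [x+v⊖x]≡v v x≤N ⟩
      v                             ∎)
    where open ≡-Reasoning

  _∈⟨_⟩ : ℕ → ℕ → Set
  a ∈⟨ x ⟩ = ∃ λ t → [ t * x ] ≡ [ a ]

  extend-grows : ∀ {a x B} → x ≤ N → a ∈⟨ x ⟩ → [ 0 ] ∈ B → [ a ] ∉ extend x B → B ⊂ extend x B
  extend-grows {a} {x} {B} x≤N (T , [Tx]≡[a]) 0∈B a∉ with
    boundary (λ t → [ t * x ] ∈? B) 0∈B T (a∉ ∘ ∈-extend⁺ˡ x ∘ subst (_∈ B) [Tx]≡[a])
  ... | t , tx∈B , [1+t]x∉B = ∈-extend⁺ˡ x , [ suc t * x ] , [x+u]∈extend (t * x) x≤N tx∈B , [1+t]x∉B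

  ∣foldr-extend∣-grows : ∀ {a A} l → List.All (λ x → x ≤ N × a ∈⟨ x ⟩) l → [ 0 ] ∈ A →
                         [ a ] ∉ foldr extend A l → ∣ A ∣ + length l ≤ ∣ foldr extend A l ∣
  ∣foldr-extend∣-grows {A = A} [] [] 0∈A a∉ = ≤-reflexive (+-identityʳ ∣ A ∣)
  ∣foldr-extend∣-grows {a} {A} (x ∷ l) ((x≤N , a∈⟨x⟩) ∷ l-ok) 0∈A a∉ = begin
    ∣ A ∣ + suc (length l)    ≡⟨ +-suc ∣ A ∣ (length l) ⟩
    suc (∣ A ∣ + length l)    ≤⟨ s≤s (∣foldr-extend∣-grows l l-ok 0∈A (a∉ ∘ ∈-extend⁺ˡ x)) ⟩
    suc ∣ B ∣                 ≤⟨ p⊂q⇒∣p∣<∣q∣ (extend-grows x≤N a∈⟨x⟩ (⊆-foldr-extend l 0∈A) a∉) ⟩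
    ∣ extend x B ∣            ∎
    where
    open ≤-Reasoning
    B : Subset N
    B = foldr extend A l

  NonZeroResidue : ℕ → Set
  NonZeroResidue x = x < N × x ≢ 0

  []-injective : ∀ {u w} → u < N → w < N → [ u ] ≡ [ w ] → u ≡ w
  []-injective u<N w<N [u]≡[w] = trans (sym (toℕ-[]-< u<N)) (trans (cong toℕ [u]≡[w]) (toℕ-[]-< w<N))

  [x]≢[0] : ∀ {x} → NonZeroResidue x → [ x ] ≢ [ 0 ]
  [x]≢[0] (x<N , x≢0) = x≢0 ∘ []-injective x<N (>-nonZero⁻¹ N)

  [x+0]≡[x] : ∀ x → [ x + 0 ] ≡ [ x ]
  [x+0]≡[x] x = cong [_] (+-identityʳ x)

  v⊖x≡[0]⇒v≡[x] : ∀ {v x} → x ≤ N → v ⊖ x ≡ [ 0 ] → v ≡ [ x ]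
  v⊖x≡[0]⇒v≡[x] {v} {x} x≤N v⊖x≡[0] = begin
    v                       ≡⟨ [x+v⊖x]≡v v x≤N ⟨
    [ x + toℕ (v ⊖ x) ]     ≡⟨ cong (λ w → [ x + toℕ w ]) v⊖x≡[0] ⟩
    [ x + toℕ [ 0 ] ]       ≡⟨ [u+toℕ[w]] x 0 ⟩
    [ x + 0 ]               ≡⟨ [x+0]≡[x] x ⟩
    [ x ]                   ∎
    where open ≡-Reasoning

  4≤∣sums[x,y]∣ : ∀ {x y} → NonZeroResidue x → NonZeroResidue y → y ≢ x → [ x + y ] ≢ [ 0 ] →
                  4 ≤ ∣ sums (x ∷ y ∷ []) ∣
  4≤∣sums[x,y]∣ {x} {y} x≠0@(x<N , _) y≠0@(y<N , _) y≢x [x+y]≢[0] = begin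
    2 + 2             ≤⟨ +-monoʳ-≤ 2 (subst (λ k → suc k ≤ ∣ sums[y] ∣) (∣⁅x⁆∣≡1 [ 0 ])
                                          (p⊂q⇒∣p∣<∣q∣ ⁅0⁆⊂sums[y])) ⟩
    2 + ∣ sums[y] ∣   ≤⟨ x,y∈q─p⇒2+∣p∣≤∣q∣ (∈-extend⁺ˡ x) [x]∈ [x+y]∈ [x]∉ [x+y]∉ [x]≢[x+y] ⟩
    ∣ extend x sums[y] ∣ ∎
    where
    open ≤-Reasoning
    sums[y] : Subset N
    sums[y] = sums (y ∷ [])
    [y]∈sums[y] : [ y ] ∈ sums[y]
    [y]∈sums[y] = subst (_∈ sums[y]) ([x+0]≡[x] y) ([x+u]∈extend 0 (<⇒≤ y<N) (x∈⁅x⁆ [ 0 ]))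
    ⁅0⁆⊂sums[y] : ⁅ [ 0 ] ⁆ ⊂ sums[y]
    ⁅0⁆⊂sums[y] = ∈-extend⁺ˡ y , [ y ] , [y]∈sums[y] , [x]≢[0] y≠0 ∘ x∈⁅y⁆⇒x≡y [ 0 ]
    [x]∈ : [ x ] ∈ extend x sums[y]
    [x]∈ = subst (_∈ extend x sums[y]) ([x+0]≡[x] x) ([x+u]∈extend 0 (<⇒≤ x<N) ([0]∈sums (y ∷ [])))
    [x+y]∈ : [ x + y ] ∈ extend x sums[y]
    [x+y]∈ = [x+u]∈extend y (<⇒≤ x<N) [y]∈sums[y]
    [x]∉ : [ x ] ∉ sums[y]
    [x]∉ [x]∈ with ∈-extend⁻ y [x]∈
    ... | inj₁ [x]∈⁅0⁆   = [x]≢[0] x≠0 (x∈⁅y⁆⇒x≡y _ [x]∈⁅0⁆)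
    ... | inj₂ [x]⊖y∈⁅0⁆ = y≢x ([]-injective y<N x<N (sym (v⊖x≡[0]⇒v≡[x] (<⇒≤ y<N) (x∈⁅y⁆⇒x≡y _ [x]⊖y∈⁅0⁆))))
    [x+y]∉ : [ x + y ] ∉ sums[y]
    [x+y]∉ [x+y]∈ with ∈-extend⁻ y [x+y]∈
    ... | inj₁ [x+y]∈⁅0⁆   = [x+y]≢[0] (x∈⁅y⁆⇒x≡y _ [x+y]∈⁅0⁆)
    ... | inj₂ [x+y]⊖y∈⁅0⁆ = [x]≢[0] x≠0 (trans (sym [x+y]⊖y≡[x]) (x∈⁅y⁆⇒x≡y _ [x+y]⊖y∈⁅0⁆))
      where
      [x+y]⊖y≡[x] : [ x + y ] ⊖ y ≡ [ x ]
      [x+y]⊖y≡[x] = trans (cong (λ z → [ z ] ⊖ y) (+-comm x y)) ([x+u]⊖x≡[u] x (<⇒≤ y<N))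
    [x]≢[x+y] : [ x ] ≢ [ x + y ]
    [x]≢[x+y] [x]≡[x+y] = [x]≢[0] y≠0 (
      trans (sym ([x+u]⊖x≡[u] y (<⇒≤ x<N))) (
      trans (cong (_⊖ x) (sym [x]≡[x+y])) (
      trans (cong (_⊖ x) (sym ([x+0]≡[x] x))) ([x+u]⊖x≡[u] 0 (<⇒≤ x<N)))))

  sums⊆multiples : ∀ {p} l → p ∣ N → List.All (p ∣_) l → ∀ {v} → v ∈ sums l → p ∣ toℕ v
  sums⊆multiples {p} [] p∣N [] v∈⁅0⁆ =
    subst (λ w → p ∣ toℕ w) (sym (x∈⁅y⁆⇒x≡y _ v∈⁅0⁆)) (subst (p ∣_) (sym (toℕ-[] 0)) (%-presˡ-∣ (p ∣0) p∣N))
  sums⊆multiples {p} (x ∷ l) p∣N (p∣x ∷ p∣l) {v} v∈ with ∈-extend⁻ x v∈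
  ... | inj₁ v∈sums   = sums⊆multiples l p∣N p∣l v∈sums
  ... | inj₂ v⊖x∈sums = ∣m+n∣m⇒∣n (subst (p ∣_) (+-comm (toℕ v) (N ∸ x)) p∣v+[N∸x]) (∣m∣n⇒∣m∸n p∣N p∣x)
    where
    p∣v+[N∸x] : p ∣ toℕ v + (N ∸ x)
    p∣v+[N∸x] = ∣n∣m%n⇒∣m p∣N (subst (p ∣_) (toℕ-[] (toℕ v + (N ∸ x))) (sums⊆multiples l p∣N p∣l v⊖x∈sums))

  [t*x]∈sums[replicate] : ∀ {t n x} l → t ≤ n → x ≤ N → [ t * x ] ∈ sums (replicate n x ++ l)
  [t*x]∈sums[replicate] {zero}  {n}     l _         _   = [0]∈sums (replicate n _ ++ l)
  [t*x]∈sums[replicate] {suc t} {suc n} l (s≤s t≤n) x≤N = [x+u]∈extend (t * _) x≤N ([t*x]∈sums[replicate] l t≤n x≤N)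

  1+n≡u%N⇒n≡[u+N∸1]%N : ∀ {n u} → n < N → suc n ≡ u % N → n ≡ (u + (N ∸ 1)) % N
  1+n≡u%N⇒n≡[u+N∸1]%N {n} {u} n<N 1+n≡u%N = begin
    n                         ≡⟨ m<n⇒m%n≡m n<N ⟨
    n % N                     ≡⟨ [m+n]%n≡m%n n N ⟨
    (n + N) % N               ≡⟨ cong (λ k → (n + k) % N) (m+[n∸m]≡n (>-nonZero⁻¹ N)) ⟨
    (n + suc (N ∸ 1)) % N     ≡⟨ cong (_% N) (+-suc n (N ∸ 1)) ⟩
    (suc n + (N ∸ 1)) % N     ≡⟨ cong (λ k → (k + (N ∸ 1)) % N) 1+n≡u%N ⟩
    (u % N + (N ∸ 1)) % N     ≡⟨ [m%n+o]%n≡[m+o]%n u (N ∸ 1) N ⟩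
    (u + (N ∸ 1)) % N         ∎
    where open ≡-Reasoning

  [a*x⁻¹]*x≡[a] : ∀ a {x x⁻¹} → (x * x⁻¹) % N ≡ 1 → [ (a * x⁻¹) % N * x ] ≡ [ a ]
  [a*x⁻¹]*x≡[a] a {x} {x⁻¹} x*x⁻¹≡1 = []-cong (begin
    (a * x⁻¹ % N * x) % N      ≡⟨ [m%n*o]%n≡[m*o]%n (a * x⁻¹) x N ⟩
    (a * x⁻¹ * x) % N          ≡⟨ cong (_% N) (solve 3 (λ a x⁻¹ x → a :* x⁻¹ :* x := a :* (x :* x⁻¹))
                                                       refl a x⁻¹ x) ⟩
    (a * (x * x⁻¹)) % N        ≡⟨ [m*[o%n]]%n≡[m*o]%n a (x * x⁻¹) N ⟨
    (a * ((x * x⁻¹) % N)) % N  ≡⟨ cong (λ k → (a * k) % N) x*x⁻¹≡1 ⟩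
    (a * 1) % N                ≡⟨ cong (_% N) (*-identityʳ a) ⟩
    a % N                      ∎)
    where open ≡-Reasoning

  module Avoiding (a : ℕ) (a∈⟨nonzero⟩ : ∀ {x} → NonZeroResidue x → a ∈⟨ x ⟩) where

    generators : ∀ {l} → List.All NonZeroResidue l → List.All (λ x → x ≤ N × a ∈⟨ x ⟩) l
    generators = List.map (λ x≠0 → <⇒≤ (proj₁ x≠0) , a∈⟨nonzero⟩ x≠0)

    1+length≤∣sums∣ : ∀ {l} → List.All NonZeroResidue l → [ a ] ∉ sums l → 1 + length l ≤ ∣ sums l ∣
    1+length≤∣sums∣ {l} l≠0 a∉ = subst (λ k → k + length l ≤ ∣ sums l ∣) (∣⁅x⁆∣≡1 [ 0 ])
      (∣foldr-extend∣-grows l (generators l≠0) (x∈⁅x⁆ [ 0 ]) a∉)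

    record Extremal (l : List ℕ) : Set where
      field
        nonzero : List.All NonZeroResidue l
        length≡ : length l ≡ N ∸ 2
        avoids  : [ a ] ∉ sums l

    open Extremal

    Extremal-resp-↭ : ∀ {l l'} → l ↭ l' → Extremal l → Extremal l'
    Extremal-resp-↭ π e = record
      { nonzero = All-resp-↭ π (nonzero e)
      ; length≡ = trans (sym (↭-length π)) (length≡ e)
      ; avoids  = avoids e ∘ sums-↭ (↭.↭-sym π)
      }

    Extremal⇒cover : ∀ {l} → Extremal l → ∀ v → v ≢ [ a ] → v ∈ sums l
    Extremal⇒cover {l} e v v≢a with v ∈? sums l
    ... | yes v∈ = v∈
    ... | no  v∉ = contradiction 3+[N∸2]≤N (<⇒≱ (s≤s (m≤n+m∸n N 2)))
      where
      open ≤-Reasoning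
      3+[N∸2]≤N : 3 + (N ∸ 2) ≤ N
      3+[N∸2]≤N = begin
        2 + (1 + (N ∸ 2))   ≡⟨ cong (λ k → 2 + (1 + k)) (length≡ e) ⟨
        2 + (1 + length l)  ≤⟨ +-monoʳ-≤ 2 (1+length≤∣sums∣ (nonzero e) (avoids e)) ⟩
        2 + ∣ sums l ∣      ≤⟨ x,y∈q─p⇒2+∣p∣≤∣q∣ ⊆⊤ ∈⊤ ∈⊤ v∉ (avoids e) v≢a ⟩
        ∣ ⊤ {N} ∣           ≡⟨ ∣⊤∣≡n N ⟩
        N                   ∎

    Extremal⇒no-pair : ∀ {x y l} → Extremal (x ∷ y ∷ l) → y ≢ x → [ x + y ] ≢ [ 0 ] → ⊥
    Extremal⇒no-pair {x} {y} {l} e@record { nonzero = x≠0 ∷ y≠0 ∷ l≠0 } y≢x [x+y]≢[0] =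
      <⇒≱ (∉⇒∣p∣<n a∉S) N≤∣S∣
      where
      S : Subset N
      S = foldr extend (sums (x ∷ y ∷ [])) l
      a∉S : [ a ] ∉ S
      a∉S = avoids e ∘ sums-↭ (++-comm l (x ∷ y ∷ []))
                     ∘ subst ([ a ] ∈_) (sym (foldr-++ extend ⁅ [ 0 ] ⁆ l (x ∷ y ∷ [])))
      N≤∣S∣ : N ≤ ∣ S ∣
      N≤∣S∣ = begin
        N                                  ≤⟨ m≤n+m∸n N 2 ⟩
        2 + (N ∸ 2)                        ≡⟨ cong (2 +_) (length≡ e) ⟨
        4 + length l                       ≤⟨ +-monoˡ-≤ (length l) (4≤∣sums[x,y]∣ x≠0 y≠0 y≢x [x+y]≢[0]) ⟩
        ∣ sums (x ∷ y ∷ []) ∣ + length l    ≤⟨ ∣foldr-extend∣-grows l (generators l≠0) ([0]∈sums (x ∷ y ∷ [])) a∉S ⟩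
        ∣ S ∣                              ∎
        where open ≤-Reasoning

    Extremal⇒±x : ∀ {x l} → Extremal (x ∷ l) → List.All (λ y → y ≡ x ⊎ y ≡ N ∸ x) l
    Extremal⇒±x {x} {l} e@record { nonzero = (x<N , x≢0) ∷ l≠0 } = List.tabulate ±x
      where
      ±x : ∀ {y} → y ∈ₗ l → y ≡ x ⊎ y ≡ N ∸ x
      ±x {y} y∈l with mid , post , refl ← ∈-∃++ y∈l with y ≟ x
      ... | yes y≡x = inj₁ y≡x
      ... | no  y≢x with [ x + y ] Fin.≟ [ 0 ]
      ...   | no [x+y]≢[0] =
        ⊥-elim (Extremal⇒no-pair (Extremal-resp-↭ (↭.prep x (shift y mid post)) e) y≢x [x+y]≢[0])
      ...   | yes [x+y]≡[0] =
        inj₂ ([]-injective (proj₁ (List.lookup l≠0 y∈l)) (∸-monoʳ-< (n≢0⇒n>0 x≢0) (<⇒≤ x<N)) (begin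
              [ y ]                   ≡⟨ [x+u]⊖x≡[u] y (<⇒≤ x<N) ⟨
              [ x + y ] ⊖ x           ≡⟨ cong (_⊖ x) [x+y]≡[0] ⟩
              [ toℕ [ 0 ] + (N ∸ x) ] ≡⟨ [toℕ[u]+w] 0 (N ∸ x) ⟩
              [ N ∸ x ]               ∎))
        where open ≡-Reasoning

    Extremal⇒¬all-multiples : ∀ {p l} → 1 < p → p ∣ N → 2 < N → Extremal l → ¬ List.All (p ∣_) l
    Extremal⇒¬all-multiples {p} {l} 1<p p∣N 2<N e p∣l = <⇒≢ 1<p (sym (∣1⇒≡1 p∣1))
      where
      1<N : 1 < N
      1<N = <⇒≤ 2<N
      N∸1<N : N ∸ 1 < N
      N∸1<N = ∸-monoʳ-< (s≤s z≤n) (<⇒≤ 1<N)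
      p∣ : ∀ v → v ≢ [ a ] → p ∣ toℕ v
      p∣ v v≢a = sums⊆multiples l p∣N p∣l (Extremal⇒cover e v v≢a)
      -- one of the residues 1 and −1 is not a, hence lies in sums l
      p∣1 : p ∣ 1
      p∣1 with [ 1 ] Fin.≟ [ a ]
      ... | no [1]≢[a]  = subst (p ∣_) (toℕ-[]-< 1<N) (p∣ [ 1 ] [1]≢[a])
      ... | yes [1]≡[a] = subst (p ∣_) (m∸[m∸n]≡n (<⇒≤ 1<N))
                            (∣m∣n⇒∣m∸n p∣N (subst (p ∣_) (toℕ-[]-< N∸1<N) (p∣ [ N ∸ 1 ] [N∸1]≢[a])))
        where
        [N∸1]≢[a] : [ N ∸ 1 ] ≢ [ a ]
        [N∸1]≢[a] [N∸1]≡[a] =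
          <⇒≢ (∸-monoˡ-< 2<N (s≤s z≤n)) (sym ([]-injective N∸1<N 1<N (trans [N∸1]≡[a] (sym [1]≡[a]))))

    Extremal⇒¬p∣x : ∀ {p x l} → 1 < p → p ∣ N → Extremal (x ∷ l) → ¬ p ∣ x
    Extremal⇒¬p∣x {p} {x} 1<p p∣N e p∣x =
      Extremal⇒¬all-multiples 1<p p∣N 2<N e (p∣x ∷ List.map p∣±x (Extremal⇒±x e))
      where
      2<N : 2 < N
      2<N = m∸n≢0⇒n<m (λ N∸2≡0 → 1+n≢0 (trans (length≡ e) N∸2≡0))
      p∣±x : ∀ {y} → y ≡ x ⊎ y ≡ N ∸ x → p ∣ y
      p∣±x (inj₁ refl) = p∣x
      p∣±x (inj₂ refl) = ∣m∣n⇒∣m∸n p∣N p∣x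

    Extremal⇒1+n≡a*x⁻¹ : ∀ {x x⁻¹ n m} → NonZeroResidue x → (x * x⁻¹) % N ≡ 1 →
                         Extremal (replicate n x ++ replicate m (N ∸ x)) → suc n ≡ (a * x⁻¹) % N
    Extremal⇒1+n≡a*x⁻¹ {x} {x⁻¹} {n} {m} (x<N , _) x*x⁻¹≡1 e with <-cmp ((a * x⁻¹) % N) (suc n)
    ... | tri≈ _ c≡1+n _ = sym c≡1+n
    ... | tri< c<1+n _ _ = ⊥-elim (avoids e (subst (_∈ _) ([a*x⁻¹]*x≡[a] a x*x⁻¹≡1)
                             ([t*x]∈sums[replicate] (replicate m (N ∸ x)) (≤-pred c<1+n) (<⇒≤ x<N))))
    ... | tri> _ _ 1+n<c = ⊥-elim (avoids e (sums-↭ (++-comm (replicate m (N ∸ x)) (replicate n x))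
                             (subst (_∈ _) [-c*-x]≡[a] ([t*x]∈sums[replicate] (replicate n x) N∸c≤m (m∸n≤m N x)))))
      where
      c : ℕ
      c = (a * x⁻¹) % N
      -- (−c)(−x) = cx = a, and −c has a representative of size at most m
      [-c*-x]≡[a] : [ (N ∸ c) * (N ∸ x) ] ≡ [ a ]
      [-c*-x]≡[a] = trans ([]-cong ([n∸m]*[n∸o]%n≡m*o%n c x N (<⇒≤ (m%n<n (a * x⁻¹) N)) (<⇒≤ x<N)))
                          ([a*x⁻¹]*x≡[a] a x*x⁻¹≡1)
      N∸c≤m : N ∸ c ≤ m
      N∸c≤m = begin
        N ∸ c         ≤⟨ ∸-monoʳ-≤ N 1+n<c ⟩
        N ∸ (2 + n)   ≡⟨ ∸-+-assoc N 2 n ⟨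
        N ∸ 2 ∸ n     ≡⟨ cong (_∸ n) (trans (sym (length≡ e)) (length-replicate-++ n m)) ⟩
        n + m ∸ n     ≡⟨ m+n∸m≡n n m ⟩
        m             ∎
        where open ≤-Reasoning

    Extremal⇒↭Mfrak : ∀ {x x⁻¹ l} → Extremal (x ∷ l) → (x * x⁻¹) % N ≡ 1 → x ∷ l ↭ toList (Mfrak N a x x⁻¹)
    Extremal⇒↭Mfrak {x} {x⁻¹} {l} e@record { nonzero = x≠0@(x<N , x≢0) ∷ _ } x*x⁻¹≡1
      with n , m , π ← All-≡∨≡⇒↭replicate l (Extremal⇒±x e) =
      ↭.trans (↭.prep x π) (↭.↭-reflexive (sym (begin
        toList (Mfrak N a x x⁻¹)                             ≡⟨ toList-tabulate-<ᵇ x (negMod N x) k≤N∸2 ⟩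
        replicate k x ++ replicate (N ∸ 2 ∸ k) (negMod N x)  ≡⟨ cong₂ _++_ (cong (λ i → replicate i x) (sym 1+n≡k))
                                                                          (cong₂ replicate N∸2∸k≡m negMod≡) ⟩
        replicate (suc n) x ++ replicate m (N ∸ x)           ∎)))
      where
      open ≡-Reasoning
      k : ℕ
      k = mfrakN N a x⁻¹
      e' : Extremal (replicate (suc n) x ++ replicate m (N ∸ x))
      e' = Extremal-resp-↭ (↭.prep x π) e
      1+n+m≡N∸2 : suc n + m ≡ N ∸ 2
      1+n+m≡N∸2 = trans (sym (length-replicate-++ (suc n) m)) (length≡ e')
      2+n≡c : suc (suc n) ≡ (a * x⁻¹) % N
      2+n≡c = Extremal⇒1+n≡a*x⁻¹ x≠0 x*x⁻¹≡1 e'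
      1+n≡k : suc n ≡ k
      1+n≡k = trans (1+n≡u%N⇒n≡[u+N∸1]%N (subst (_≤ N) (sym 2+n≡c) (<⇒≤ (m%n<n _ N))) 2+n≡c)
                    (sym (mod≡% (a * x⁻¹ + (N ∸ 1)) N))
      k≤N∸2 : k ≤ N ∸ 2
      k≤N∸2 = subst₂ _≤_ 1+n≡k 1+n+m≡N∸2 (m≤m+n (suc n) m)
      N∸2∸k≡m : N ∸ 2 ∸ k ≡ m
      N∸2∸k≡m = trans (cong₂ _∸_ (sym 1+n+m≡N∸2) (sym 1+n≡k)) (m+n∸m≡n (suc n) m)
      negMod≡ : negMod N x ≡ N ∸ x
      negMod≡ = trans (mod≡% (N ∸ x) N) (m<n⇒m%n≡m (∸-monoʳ-< (n≢0⇒n>0 x≢0) (<⇒≤ x<N)))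

classification : ∀ {p} N .{{_ : NonZero N}} → 1 < p → p ∣ N → 2 ≤ N → ∀ {a} → a < N →
  (∀ {x} → x < N → x ≢ 0 → ∃ λ t → (t * x) % N ≡ a % N) →
  (∀ {b} → ¬ p ∣ b → ∃ λ b⁻¹ → b⁻¹ < N × (b * b⁻¹) mod N ≡ 1) →
  (as : Vec ℕ (N ∸ 2)) → All (λ x → x < N × x ≢ 0) as →
  ((S : Vec Bool (N ∸ 2)) → ¬ (subsetSum S as mod N ≡ a)) →
  Σ ℕ λ b → b < N × ¬ (p ∣ b) ×
    Σ ℕ λ b⁻¹ → b⁻¹ < N × (b * b⁻¹) mod N ≡ 1 × (toList as ↭ toList (Mfrak N a b b⁻¹))
classification (suc zero) _ _ (s≤s ())
classification (suc (suc zero)) 1<p _ _ _ _ _ [] _ _ =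
  1 , s≤s (s≤s z≤n) , <⇒≢ 1<p ∘ sym ∘ ∣1⇒≡1 , 1 , s≤s (s≤s z≤n) , refl , ↭.refl
classification {p} N@(suc (suc (suc _))) 1<p p∣N _ {a} a<N a∈⟨x⟩ inverse as@(x ∷ _) as≠0 no-sum =
  let x⁻¹ , x⁻¹<N , x*x⁻¹≡1 = inverse p∤x
  in x , proj₁ (List.head (nonzero e)) , p∤x , x⁻¹ , x⁻¹<N , x*x⁻¹≡1 ,
     Extremal⇒↭Mfrak e (trans (sym (mod≡% (x * x⁻¹) N)) x*x⁻¹≡1)
  where
  open Residues N
  a∈⟨nonzero⟩ : ∀ {x} → NonZeroResidue x → a ∈⟨ x ⟩
  a∈⟨nonzero⟩ {x} (x<N , x≢0) with t , t*x≡a ← a∈⟨x⟩ x<N x≢0 = t , []-cong {t * x} {a} t*x≡a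
  open Avoiding a a∈⟨nonzero⟩
  open Extremal
  avoids-a : [ a ] ∉ sums (toList as)
  avoids-a a∈ with S , [S]≡[a] ← ∈sums⇒subsetSum as (VecAll.map (<⇒≤ ∘ proj₁) as≠0) a∈ =
    no-sum S (begin
      subsetSum S as mod N       ≡⟨ mod≡% (subsetSum S as) N ⟩
      subsetSum S as % N         ≡⟨ toℕ-[] (subsetSum S as) ⟨
      toℕ [ subsetSum S as ]     ≡⟨ cong toℕ [S]≡[a] ⟩
      toℕ [ a ]                  ≡⟨ toℕ-[]-< a<N ⟩
      a                          ∎)
    where open ≡-Reasoning
  e : Extremal (toList as)
  e = record { nonzero = toList⁺ as≠0 ; length≡ = length-toList as ; avoids = avoids-a }
  p∤x : ¬ p ∣ x
  p∤x = Extremal⇒¬p∣x 1<p p∣N e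

lemma4 : (p r : ℕ) → Prime p → 1 ≤ r →
    (a : ℕ) → a < p ^ r → a ≢ 0 → p ^ (r ∸ 1) ∣ a →
    (as : Vec ℕ (p ^ r ∸ 2)) →
    All (λ x → x < p ^ r × x ≢ 0) as →
    ((S : Vec Bool (p ^ r ∸ 2)) → ¬ (subsetSum S as mod (p ^ r) ≡ a)) →
    Σ ℕ λ b → b < p ^ r × ¬ (p ∣ b) ×
      Σ ℕ λ binv → binv < p ^ r × (b * binv) mod (p ^ r) ≡ 1 ×
        (toList as ↭ toList (Mfrak (p ^ r) a b binv))
-- The hypothesis a ≢ 0 is redundant: the empty subset sum is 0.
lemma4 p r@(suc k) pr _ a a<N _ p^k∣a = classification N 1<p (m∣m*n (p ^ k)) 1<N a<N a∈⟨x⟩ inverse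
  where
  N : ℕ
  N = p ^ r
  instance
    p≢0 : NonZero p
    p≢0 = prime⇒nonZero pr
    N≢0 : NonZero N
    N≢0 = m^n≢0 p r
  1<p : 1 < p
  1<p = nonTrivial⇒n>1 p {{prime⇒nonTrivial pr}}
  1<N : 1 < N
  1<N = ^-monoʳ-< p 1<p {0} {r} (s≤s z≤n)
  a∈⟨x⟩ : ∀ {x} → x < N → x ≢ 0 → ∃ λ t → (t * x) % N ≡ a % N
  a∈⟨x⟩ x<N x≢0 = p^k∣a⇒a∈⟨x⟩ k pr p^k∣a (n≢0⇒n>0 x≢0) x<N
  inverse : ∀ {b} → ¬ p ∣ b → ∃ λ b⁻¹ → b⁻¹ < N × (b * b⁻¹) mod N ≡ 1
  inverse {b} p∤b with b⁻¹ , b⁻¹<N , b*b⁻¹≡1 ← ¬∣⇒∃inverse r pr p∤b =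
    b⁻¹ , b⁻¹<N , trans (mod≡% (b * b⁻¹) N) (trans b*b⁻¹≡1 (m<n⇒m%n≡m 1<N))
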